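{- Consider the game $\mathcal{R}(K_{\aleph_0}^{(3)}, G)$ with $G=\hat{K}_{2,4}^{(3)}$, and suppose that at some position of a play (in which nobody has won yet) $P_2$ has claimed a copy of $\hat{K}_{2,3}^{(3)}$ with main vertices $x,y$ and center $c$ (i.e. $P_2$ has claimed the edges $cxy, cxu_1,cxu_2,cxu_3,cyu_1,cyu_2,cyu_3$ for some distinct vertices $u_1,u_2,u_3$), such that (i) $P_1$ does not have a threat; (ii) $P_1$ has not claimed a copy of $\hat{K}_{2,3}^{(3)}$ with center $c$ and main vertex $x$; (iii) $P_1$ has not claimed a copy of $\hat{K}_{2,3}^{(3)}$ with center $x$ and main vertex $c$. If it is $P_2$'s turn, then $P_2$ has a drawing strategy from this position, i.e. a strategy guaranteeing that $P_1$ does not win.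
   Context: Strong Ramsey game $\mathcal{R}(B,G)$: players $P_1$, $P_2$ alternately color uncolored edges of the $k$-uniform board $B$ in their own color, $P_1$ first; whoever first completes a monochromatic copy of the target $G$ in their own color wins; if nobody does in finitely many moves, it is a draw. $K_{\aleph_0}^{(3)}$ is the complete $3$-uniform hypergraph on countably many vertices. $\hat{K}_{2,l}$ is $K_{2,l}$ plus the edge joining its two vertices of degree $l$; for a graph $H$, $H^{(3)}$ is obtained by adding one fixed new vertex (the center) to every edge of $H$. In $\hat{K}_{2,l}^{(3)}$, the main vertices are the two vertices of degree $l+1$ in $\hat{K}_{2,l}$, and the center is the added vertex; so $\hat{K}_{2,l}^{(3)}$ with center $c$ and main vertices $x,y$ consists of the edges $cxy$ and $cxu_i, cyu_i$ for $l$ distinct vertices $u_i$. "$\hat{K}_{2,3}^{(3)}$ with center $c$ and main vertex $x$" means a copy in which $c$ is the center and $x$ is one of the two main vertices. $P_1$ has a threat if she has claimed all edges of a copy of $G-e$ (for some edge $e$ of $G$) in the board such that the edge of the board corresponding to $e$ is not yet claimed by either player. -}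

module Defs where

open import Data.Nat using (ℕ; suc)
open import Data.Fin using (Fin)
open import Data.Bool using (Bool; true; false)
open import Data.Maybe using (Maybe; just; nothing)
open import Data.Product using (_×_; _,_; Σ; ∃; ∃-syntax)
open import Data.Sum using (_⊎_)
open import Data.List using (List; []; _∷_; length)
open import Data.List.Relation.Unary.Any using (Any)
open import Relation.Binary.PropositionalEquality using (_≡_; _≢_)
open import Relation.Nullary using (¬_)
open import Function.Definitions using (Injective)

-- An edge is given by a triple of vertices; it is a genuine edge when the three
-- vertices are distinct, and two triples denote the same edge when they have the
-- same underlying vertex set.
Vertex : Set
Vertex = ℕ

Edge : Set
Edge = Vertex × Vertex × Vertex

IsEdge : Edge → Set
IsEdge (a , b , c) = (a ≢ b) × (a ≢ c) × (b ≢ c)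

_∈ᵉ_ : Vertex → Edge → Set
v ∈ᵉ (a , b , c) = (v ≡ a) ⊎ (v ≡ b) ⊎ (v ≡ c)

SameEdge : Edge → Edge → Set
SameEdge e f = ∀ v → ((v ∈ᵉ e → v ∈ᵉ f) × (v ∈ᵉ f → v ∈ᵉ e))

Claimed : List Edge → Edge → Set
Claimed S e = Any (SameEdge e) S

-- Position: edges claimed by P1 (red) and by P2 (blue).
record Pos : Set where
  constructor pos
  field
    red  : List Edge
    blue : List Edge
open Pos public

addRed : Edge → Pos → Pos
addRed e (pos r b) = pos (e ∷ r) b

addBlue : Edge → Pos → Pos
addBlue e (pos r b) = pos r (e ∷ b)

Free : Pos → Edge → Set
Free p e = IsEdge e × ¬ Claimed (red p) e × ¬ Claimed (blue p) e

KVerts : (l : ℕ) → Vertex → Vertex → Vertex → (Fin l → Vertex) → Set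
KVerts l c x y u =
  (c ≢ x) × (c ≢ y) × (x ≢ y) × Injective _≡_ _≡_ u ×
  (∀ i → (u i ≢ c) × (u i ≢ x) × (u i ≢ y))

KEdgeIx : ℕ → Set
KEdgeIx l = Maybe (Bool × Fin l)

kEdge : {l : ℕ} → Vertex → Vertex → Vertex → (Fin l → Vertex) → KEdgeIx l → Edge
kEdge c x y u nothing            = (c , x , y)
kEdge c x y u (just (false , i)) = (c , x , u i)
kEdge c x y u (just (true , i))  = (c , y , u i)

KCopy : (l : ℕ) → List Edge → Vertex → Vertex → Vertex → (Fin l → Vertex) → Set
KCopy l S c x y u = KVerts l c x y u × (∀ j → Claimed S (kEdge c x y u j))

HasG : List Edge → Set
HasG S = ∃[ c ] ∃[ x ] ∃[ y ] ∃[ u ] KCopy 4 S c x y u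

Threat : Pos → Set
Threat p = ∃[ c ] ∃[ x ] ∃[ y ] ∃[ u ] Σ (KEdgeIx 4) λ j →
  KVerts 4 c x y u ×
  (∀ j' → j' ≢ j → Claimed (red p) (kEdge c x y u j')) ×
  ¬ Claimed (red p) (kEdge c x y u j) × ¬ Claimed (blue p) (kEdge c x y u j)

data Turn : Set where
  P1turn P2turn : Turn

data PlayPos : Pos → Turn → Set where
  start : PlayPos (pos [] []) P1turn
  move1 : ∀ {p e} → PlayPos p P1turn → Free p e → ¬ HasG (e ∷ red p) →
          PlayPos (addRed e p) P2turn
  move2 : ∀ {p e} → PlayPos p P2turn → Free p e → ¬ HasG (e ∷ blue p) →
          PlayPos (addBlue e p) P1turn

-- A P2 strategy: a choice of move for each position (positions are ordered lists,
-- so they record the whole history of the play).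
Strategy : Set
Strategy = Pos → Edge

data Consistent (σ : Strategy) (p0 : Pos) : Pos → Set where
  here : Consistent σ p0 p0
  step : ∀ {p e} → Consistent σ p0 p →
         ¬ HasG (σ p ∷ blue p) →
         Free (addBlue (σ p) p) e →
         ¬ HasG (e ∷ red p) →
         Consistent σ p0 (addRed e (addBlue (σ p) p))

DrawingStrategy : Strategy → Pos → Set
DrawingStrategy σ p0 = ∀ p → Consistent σ p0 p →
  Free p (σ p) ×
  (¬ HasG (σ p ∷ blue p) → ∀ e → Free (addBlue (σ p) p) e → ¬ HasG (e ∷ red p))

{-# OPTIONS --safe #-}
module Submission where

-- P₂ answers each move of P₁ with an edge c y w through a brand-new vertex w. Unless P₁ replies
-- with c x w, P₂ plays c x w next and completes a copy of K̂_{2,4}. The forced reply c x w is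
-- harmless for P₁: w lies on no other red edge, whereas every vertex of a copy of K̂_{2,3}, and every
-- vertex of a copy of K̂_{2,4} minus one edge, lies on at least two of its present edges, except a
-- leaf u_i whose second edge is the missing one. In that case the present edge through u_i = w is
-- c x w, so deleting u_i leaves a red K̂_{2,3} whose center and one main vertex are c and x (in some
-- order), which (ii) and (iii) exclude. So P₁ never gets a threat, and without a threat she cannot
-- win on her next move.

open import Defs
open import Data.Nat using (ℕ; suc; _≤_; _<_; _⊔_; s≤s)
open import Data.Nat.Properties using (≤-trans; m≤m⊔n; m≤n⊔m; <⇒≱) renaming (_≟_ to _≟ℕ_)
open import Data.Fin using (Fin; zero; suc; punchIn)
open import Data.Fin.Properties using (punchIn-injective; punchInᵢ≢i; any?; all?)
  renaming (_≟_ to _≟ᶠ_)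
open import Data.Bool using (true; false) renaming (_≟_ to _≟ᵇ_)
open import Data.Maybe using (just; nothing)
import Data.Maybe as Maybe
import Data.Maybe.Properties as Maybe
import Data.Product.Properties as Product
open import Data.Product using (_×_; _,_; Σ; ∃; ∃-syntax; proj₁; proj₂; swap)
open import Data.Sum using (_⊎_; inj₁; inj₂; [_,_]′)
open import Data.List using (List; []; _∷_)
import Data.List.Relation.Unary.Any as Any
open Any using (here; there)
import Data.Vec.Functional as Vector
open import Data.Empty using (⊥; ⊥-elim)
open import Relation.Binary.PropositionalEquality using (_≡_; _≢_; refl; sym; trans; cong; subst)
open import Relation.Binary.Definitions using (DecidableEquality)
open import Relation.Nullary using (¬_; Dec; yes; no; ¬?; _×-dec_; _⊎-dec_)
open import Relation.Nullary.Decidable using (map′; decidable-stable)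
open import Function using (_∘_; id; case_of_)
open import Function.Definitions using (Injective)

variable
  l : ℕ
  a b d a′ b′ c x y c′ x′ y′ v w : Vertex
  e f g : Edge
  S : List Edge
  u : Fin l → Vertex
  p : Pos

-- Edges as vertex sets

∈ᵉ₁ : a ∈ᵉ (a , b , d)
∈ᵉ₁ = inj₁ refl

∈ᵉ₂ : b ∈ᵉ (a , b , d)
∈ᵉ₂ = inj₂ (inj₁ refl)

∈ᵉ₃ : d ∈ᵉ (a , b , d)
∈ᵉ₃ = inj₂ (inj₂ refl)

∉-triple : v ≢ a → v ≢ b → v ≢ d → ¬ v ∈ᵉ (a , b , d)
∉-triple v≢a v≢b v≢d = [ v≢a , [ v≢b , v≢d ]′ ]′

SameEdge-refl : SameEdge e e
SameEdge-refl v = id , id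

SameEdge-sym : SameEdge e f → SameEdge f e
SameEdge-sym e~f v = swap (e~f v)

SameEdge-trans : SameEdge e f → SameEdge f g → SameEdge e g
SameEdge-trans e~f f~g v = proj₁ (f~g v) ∘ proj₁ (e~f v) , proj₂ (e~f v) ∘ proj₂ (f~g v)

SameEdge-swap₂₃ : SameEdge (a , b , d) (a , d , b)
SameEdge-swap₂₃ v = swap₂₃ , swap₂₃
  where
  swap₂₃ : ∀ {a b d} → v ∈ᵉ (a , b , d) → v ∈ᵉ (a , d , b)
  swap₂₃ (inj₁ v≡a)        = inj₁ v≡a
  swap₂₃ (inj₂ (inj₁ v≡b)) = inj₂ (inj₂ v≡b)
  swap₂₃ (inj₂ (inj₂ v≡d)) = inj₂ (inj₁ v≡d)

∈ᵉ-resp : SameEdge e f → v ∈ᵉ e → v ∈ᵉ f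
∈ᵉ-resp e~f = proj₁ (e~f _)

vertex-separates : v ∈ᵉ e → ¬ v ∈ᵉ f → ¬ SameEdge e f
vertex-separates v∈e v∉f e~f = v∉f (∈ᵉ-resp e~f v∈e)

Claimed-resp : SameEdge e f → Claimed S e → Claimed S f
Claimed-resp e~f = Any.map (SameEdge-trans (SameEdge-sym e~f))

same-pair-through : SameEdge (a , b , w) (a′ , b′ , w) → a ≢ b → w ≢ a → w ≢ b →
                    (a ≡ a′ × b ≡ b′) ⊎ (a ≡ b′ × b ≡ a′)
same-pair-through s a≢b w≢a w≢b with ∈ᵉ-resp s ∈ᵉ₁ | ∈ᵉ-resp s ∈ᵉ₂
... | inj₁ a≡a′        | inj₂ (inj₁ b≡b′) = inj₁ (a≡a′ , b≡b′)
... | inj₂ (inj₁ a≡b′) | inj₁ b≡a′        = inj₂ (a≡b′ , b≡a′)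
... | inj₁ refl        | inj₁ refl        = ⊥-elim (a≢b refl)
... | inj₂ (inj₁ refl) | inj₂ (inj₁ refl) = ⊥-elim (a≢b refl)
... | inj₂ (inj₂ refl) | _                = ⊥-elim (w≢a refl)
... | _                | inj₂ (inj₂ refl) = ⊥-elim (w≢b refl)

_∈ᵉ?_ : (v : Vertex) (e : Edge) → Dec (v ∈ᵉ e)
v ∈ᵉ? (a , b , d) = (v ≟ℕ a) ⊎-dec (v ≟ℕ b) ⊎-dec (v ≟ℕ d)

_⊆ᵉ_ : Edge → Edge → Set
e ⊆ᵉ f = ∀ {v} → v ∈ᵉ e → v ∈ᵉ f

⊆ᵉ-intro : a ∈ᵉ f → b ∈ᵉ f → d ∈ᵉ f → (a , b , d) ⊆ᵉ f
⊆ᵉ-intro a∈f b∈f d∈f (inj₁ refl)        = a∈f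
⊆ᵉ-intro a∈f b∈f d∈f (inj₂ (inj₁ refl)) = b∈f
⊆ᵉ-intro a∈f b∈f d∈f (inj₂ (inj₂ refl)) = d∈f

_⊆ᵉ?_ : (e f : Edge) → Dec (e ⊆ᵉ f)
(a , b , d) ⊆ᵉ? f =
  map′ (λ (a∈f , b∈f , d∈f) → ⊆ᵉ-intro a∈f b∈f d∈f) (λ e⊆f → e⊆f ∈ᵉ₁ , e⊆f ∈ᵉ₂ , e⊆f ∈ᵉ₃)
       (a ∈ᵉ? f ×-dec b ∈ᵉ? f ×-dec d ∈ᵉ? f)

SameEdge? : (e f : Edge) → Dec (SameEdge e f)
SameEdge? e f = map′ antisym (λ e~f → proj₁ (e~f _) , proj₂ (e~f _)) (e ⊆ᵉ? f ×-dec f ⊆ᵉ? e)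
  where
  antisym : e ⊆ᵉ f × f ⊆ᵉ e → SameEdge e f
  antisym (e⊆f , f⊆e) v = e⊆f , f⊆e

Claimed? : (S : List Edge) (e : Edge) → Dec (Claimed S e)
Claimed? S e = Any.any? (SameEdge? e) S

IsEdge? : (e : Edge) → Dec (IsEdge e)
IsEdge? (a , b , d) = ¬? (a ≟ℕ b) ×-dec ¬? (a ≟ℕ d) ×-dec ¬? (b ≟ℕ d)

Free? : (p : Pos) (e : Edge) → Dec (Free p e)
Free? p e = IsEdge? e ×-dec ¬? (Claimed? (red p) e) ×-dec ¬? (Claimed? (blue p) e)

-- Fresh vertices

Avoids : List Edge → Vertex → Set
Avoids S w = ∀ {g} → Claimed S g → ¬ w ∈ᵉ g

avoids⇒≢ : Avoids S w → Claimed S g → v ∈ᵉ g → w ≢ v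
avoids⇒≢ avoid cl v∈g refl = avoid cl v∈g

maxVertex : List Edge → Vertex
maxVertex []                = 0
maxVertex ((a , b , d) ∷ S) = a ⊔ b ⊔ d ⊔ maxVertex S

∈ᵉ⇒≤⊔ : v ∈ᵉ (a , b , d) → v ≤ a ⊔ b ⊔ d
∈ᵉ⇒≤⊔ {a = a} {b} {d} (inj₁ refl)        = ≤-trans (m≤m⊔n a b) (m≤m⊔n (a ⊔ b) d)
∈ᵉ⇒≤⊔ {a = a} {b} {d} (inj₂ (inj₁ refl)) = ≤-trans (m≤n⊔m a b) (m≤m⊔n (a ⊔ b) d)
∈ᵉ⇒≤⊔ {a = a} {b} {d} (inj₂ (inj₂ refl)) = m≤n⊔m (a ⊔ b) d

claimed-vertex-≤-max : Claimed S g → v ∈ᵉ g → v ≤ maxVertex S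
claimed-vertex-≤-max {S = h ∷ S} (here g~h) v∈g =
  ≤-trans (∈ᵉ⇒≤⊔ (∈ᵉ-resp g~h v∈g)) (m≤m⊔n _ (maxVertex S))
claimed-vertex-≤-max {S = h ∷ S} (there cl) v∈g =
  ≤-trans (claimed-vertex-≤-max cl v∈g) (m≤n⊔m _ (maxVertex S))

above-max-avoids : maxVertex S < w → Avoids S w
above-max-avoids S<w cl w∈g = <⇒≱ S<w (claimed-vertex-≤-max cl w∈g)

fresh : Pos → Vertex
fresh p = suc (maxVertex (red p) ⊔ maxVertex (blue p))

fresh-avoids-red : ∀ p → Avoids (red p) (fresh p)
fresh-avoids-red p = above-max-avoids (s≤s (m≤m⊔n _ _))

fresh-avoids-blue : ∀ p → Avoids (blue p) (fresh p)
fresh-avoids-blue p = above-max-avoids (s≤s (m≤n⊔m _ _))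

-- Copies of K̂_{2,l}

_≟ᵢ_ : DecidableEquality (KEdgeIx l)
_≟ᵢ_ = Maybe.≡-dec (Product.≡-dec _≟ᵇ_ _≟ᶠ_)

∃-KEdgeIx? : {P : KEdgeIx l → Set} → (∀ j → Dec (P j)) → Dec (∃ P)
∃-KEdgeIx? {P = P} P? =
  map′ collect split
       (P? nothing ⊎-dec any? (λ i → P? (just (false , i))) ⊎-dec any? (λ i → P? (just (true , i))))
  where
  collect : P nothing ⊎ ∃ (λ i → P (just (false , i))) ⊎ ∃ (λ i → P (just (true , i))) → ∃ P
  collect (inj₁ P₀)              = nothing , P₀
  collect (inj₂ (inj₁ (i , Pᵢ))) = just (false , i) , Pᵢ
  collect (inj₂ (inj₂ (i , Pᵢ))) = just (true , i) , Pᵢ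
  split : ∃ P → P nothing ⊎ ∃ (λ i → P (just (false , i))) ⊎ ∃ (λ i → P (just (true , i)))
  split (nothing , P₀)          = inj₁ P₀
  split (just (false , i) , Pᵢ) = inj₂ (inj₁ (i , Pᵢ))
  split (just (true , i) , Pᵢ)  = inj₂ (inj₂ (i , Pᵢ))

leaf-sides-differ : {i : Fin l} → _≢_ {A = KEdgeIx l} (just (false , i)) (just (true , i))
leaf-sides-differ ()

AtLeaf : Fin l → KEdgeIx l → Set
AtLeaf i j = ∃[ b ] j ≡ just (b , i)

module KVertsProperties (kv : KVerts l c x y u) where

  c≢x : c ≢ x
  c≢x = proj₁ kv

  c≢y : c ≢ y
  c≢y = proj₁ (proj₂ kv)

  x≢y : x ≢ y
  x≢y = proj₁ (proj₂ (proj₂ kv))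

  u-injective : Injective _≡_ _≡_ u
  u-injective = proj₁ (proj₂ (proj₂ (proj₂ kv)))

  uᵢ≢c : ∀ i → u i ≢ c
  uᵢ≢c i = proj₁ (proj₂ (proj₂ (proj₂ (proj₂ kv))) i)

  uᵢ≢x : ∀ i → u i ≢ x
  uᵢ≢x i = proj₁ (proj₂ (proj₂ (proj₂ (proj₂ (proj₂ kv))) i))

  uᵢ≢y : ∀ i → u i ≢ y
  uᵢ≢y i = proj₂ (proj₂ (proj₂ (proj₂ (proj₂ (proj₂ kv))) i))

  y∉cxuᵢ : ∀ i → ¬ y ∈ᵉ (c , x , u i)
  y∉cxuᵢ i = ∉-triple (c≢y ∘ sym) (x≢y ∘ sym) (uᵢ≢y i ∘ sym)

  x∉cyuᵢ : ∀ i → ¬ x ∈ᵉ (c , y , u i)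
  x∉cyuᵢ i = ∉-triple (c≢x ∘ sym) x≢y (uᵢ≢x i ∘ sym)

  kEdge-distinct : {j₁ j₂ : KEdgeIx l} → j₁ ≢ j₂ → ¬ SameEdge (kEdge c x y u j₁) (kEdge c x y u j₂)
  kEdge-distinct {nothing}          {nothing}          j₁≢j₂ = ⊥-elim (j₁≢j₂ refl)
  kEdge-distinct {nothing}          {just (false , i)} _     = vertex-separates ∈ᵉ₃ (y∉cxuᵢ i)
  kEdge-distinct {nothing}          {just (true , i)}  _     = vertex-separates ∈ᵉ₂ (x∉cyuᵢ i)
  kEdge-distinct {just (false , i)} {nothing}          _     = vertex-separates ∈ᵉ₃ (y∉cxuᵢ i) ∘ SameEdge-sym
  kEdge-distinct {just (true , i)}  {nothing}          _     = vertex-separates ∈ᵉ₂ (x∉cyuᵢ i) ∘ SameEdge-sym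
  kEdge-distinct {just (false , i)} {just (true , k)}  _     = vertex-separates ∈ᵉ₂ (x∉cyuᵢ k)
  kEdge-distinct {just (true , i)}  {just (false , k)} _     = vertex-separates ∈ᵉ₂ (x∉cyuᵢ i) ∘ SameEdge-sym
  kEdge-distinct {just (false , i)} {just (false , k)} j₁≢j₂ =
    vertex-separates ∈ᵉ₃ (∉-triple (uᵢ≢c i) (uᵢ≢x i) (j₁≢j₂ ∘ cong (λ m → just (false , m)) ∘ u-injective))
  kEdge-distinct {just (true , i)}  {just (true , k)}  j₁≢j₂ =
    vertex-separates ∈ᵉ₃ (∉-triple (uᵢ≢c i) (uᵢ≢y i) (j₁≢j₂ ∘ cong (λ m → just (true , m)) ∘ u-injective))

  kEdge-through-leaf : ∀ {i} j → u i ∈ᵉ kEdge c x y u j → AtLeaf i j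
  kEdge-through-leaf nothing            uᵢ∈                = ⊥-elim (∉-triple (uᵢ≢c _) (uᵢ≢x _) (uᵢ≢y _) uᵢ∈)
  kEdge-through-leaf (just (false , k)) (inj₁ uᵢ≡c)        = ⊥-elim (uᵢ≢c _ uᵢ≡c)
  kEdge-through-leaf (just (false , k)) (inj₂ (inj₁ uᵢ≡x)) = ⊥-elim (uᵢ≢x _ uᵢ≡x)
  kEdge-through-leaf (just (false , k)) (inj₂ (inj₂ uᵢ≡uₖ)) =
    false , cong (λ m → just (false , m)) (sym (u-injective uᵢ≡uₖ))
  kEdge-through-leaf (just (true , k))  (inj₁ uᵢ≡c)        = ⊥-elim (uᵢ≢c _ uᵢ≡c)
  kEdge-through-leaf (just (true , k))  (inj₂ (inj₁ uᵢ≡y)) = ⊥-elim (uᵢ≢y _ uᵢ≡y)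
  kEdge-through-leaf (just (true , k))  (inj₂ (inj₂ uᵢ≡uₖ)) =
    true , cong (λ m → just (true , m)) (sym (u-injective uᵢ≡uₖ))

open KVertsProperties using (kEdge-distinct; kEdge-through-leaf)

another-kEdge-through : ∀ (j : KEdgeIx (suc l)) → w ∈ᵉ kEdge c x y u j →
                        ∃[ j′ ] j′ ≢ j × w ∈ᵉ kEdge c x y u j′
another-kEdge-through nothing            (inj₁ w≡c)        = just (false , zero) , (λ ()) , inj₁ w≡c
another-kEdge-through nothing            (inj₂ (inj₁ w≡x)) = just (false , zero) , (λ ()) , inj₂ (inj₁ w≡x)
another-kEdge-through nothing            (inj₂ (inj₂ w≡y)) = just (true , zero)  , (λ ()) , inj₂ (inj₁ w≡y)
another-kEdge-through (just (false , i)) (inj₁ w≡c)        = nothing , (λ ()) , inj₁ w≡c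
another-kEdge-through (just (false , i)) (inj₂ (inj₁ w≡x)) = nothing , (λ ()) , inj₂ (inj₁ w≡x)
another-kEdge-through (just (false , i)) (inj₂ (inj₂ w≡u)) = just (true , i)  , (λ ()) , inj₂ (inj₂ w≡u)
another-kEdge-through (just (true , i))  (inj₁ w≡c)        = nothing , (λ ()) , inj₁ w≡c
another-kEdge-through (just (true , i))  (inj₂ (inj₁ w≡y)) = nothing , (λ ()) , inj₂ (inj₂ w≡y)
another-kEdge-through (just (true , i))  (inj₂ (inj₂ w≡u)) = just (false , i) , (λ ()) , inj₂ (inj₂ w≡u)

kEdge-vertex : ∀ (j : KEdgeIx l) → w ∈ᵉ kEdge c x y u j → (w ≡ c ⊎ w ≡ x ⊎ w ≡ y) ⊎ ∃[ i ] w ≡ u i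
kEdge-vertex nothing            (inj₁ w≡c)        = inj₁ (inj₁ w≡c)
kEdge-vertex nothing            (inj₂ (inj₁ w≡x)) = inj₁ (inj₂ (inj₁ w≡x))
kEdge-vertex nothing            (inj₂ (inj₂ w≡y)) = inj₁ (inj₂ (inj₂ w≡y))
kEdge-vertex (just (false , i)) (inj₁ w≡c)        = inj₁ (inj₁ w≡c)
kEdge-vertex (just (false , i)) (inj₂ (inj₁ w≡x)) = inj₁ (inj₂ (inj₁ w≡x))
kEdge-vertex (just (false , i)) (inj₂ (inj₂ w≡u)) = inj₂ (i , w≡u)
kEdge-vertex (just (true , i))  (inj₁ w≡c)        = inj₁ (inj₁ w≡c)
kEdge-vertex (just (true , i))  (inj₂ (inj₁ w≡y)) = inj₁ (inj₂ (inj₂ w≡y))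
kEdge-vertex (just (true , i))  (inj₂ (inj₂ w≡u)) = inj₂ (i , w≡u)

NewVertex : Vertex → Vertex → Vertex → (Fin l → Vertex) → Vertex → Set
NewVertex c x y u w = (w ≢ c) × (w ≢ x) × (w ≢ y) × (∀ i → w ≢ u i)

NewVertex? : ∀ c x y (u : Fin l → Vertex) w → Dec (NewVertex c x y u w)
NewVertex? c x y u w =
  ¬? (w ≟ℕ c) ×-dec ¬? (w ≟ℕ x) ×-dec ¬? (w ≟ℕ y) ×-dec all? (λ i → ¬? (w ≟ℕ u i))

avoids⇒NewVertex : Avoids S w → (∀ j → Claimed S (kEdge c x y u j)) → NewVertex c x y u w
avoids⇒NewVertex avoid cl =
  avoids⇒≢ avoid (cl nothing) ∈ᵉ₁ , avoids⇒≢ avoid (cl nothing) ∈ᵉ₂ , avoids⇒≢ avoid (cl nothing) ∈ᵉ₃ ,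
  λ i → avoids⇒≢ avoid (cl (just (false , i))) ∈ᵉ₃

KVerts-∷ : KVerts l c x y u → NewVertex c x y u w → KVerts (suc l) c x y (w Vector.∷ u)
KVerts-∷ {c = c} {x = x} {y = y} {u = u} {w = w}
         (c≢x , c≢y , x≢y , u-inj , u-new) (w≢c , w≢x , w≢y , w≢u) =
  c≢x , c≢y , x≢y , inj , new
  where
  inj : Injective _≡_ _≡_ (w Vector.∷ u)
  inj {zero}  {zero}  _   = refl
  inj {zero}  {suc k} w≡u = ⊥-elim (w≢u k w≡u)
  inj {suc i} {zero}  u≡w = ⊥-elim (w≢u i (sym u≡w))
  inj {suc i} {suc k} u≡u = cong suc (u-inj u≡u)
  new : ∀ i → ((w Vector.∷ u) i ≢ c) × ((w Vector.∷ u) i ≢ x) × ((w Vector.∷ u) i ≢ y)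
  new zero    = w≢c , w≢x , w≢y
  new (suc i) = u-new i

KCopy-extend : KCopy l S c x y u → Claimed S (c , x , w) → Claimed S (c , y , w) →
               NewVertex c x y u w → KCopy (suc l) S c x y (w Vector.∷ u)
KCopy-extend {S = S} {c = c} {x = x} {y = y} {u = u} {w} (kv , cl) cxw cyw new =
  KVerts-∷ kv new , claimed
  where
  claimed : ∀ j → Claimed S (kEdge c x y (w Vector.∷ u) j)
  claimed nothing                = cl nothing
  claimed (just (false , zero))  = cxw
  claimed (just (true , zero))   = cyw
  claimed (just (false , suc i)) = cl (just (false , i))
  claimed (just (true , suc i))  = cl (just (true , i))

KCopy-swap : KCopy l S c x y u → KCopy l S c y x u
KCopy-swap {S = S} {c = c} {x = x} {y = y} {u = u} ((c≢x , c≢y , x≢y , u-inj , u-new) , cl) =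
  (c≢y , c≢x , x≢y ∘ sym , u-inj , λ i → let (uᵢ≢c , uᵢ≢x , uᵢ≢y) = u-new i in uᵢ≢c , uᵢ≢y , uᵢ≢x) ,
  claimed
  where
  claimed : ∀ j → Claimed S (kEdge c y x u j)
  claimed nothing            = Claimed-resp SameEdge-swap₂₃ (cl nothing)
  claimed (just (false , i)) = cl (just (true , i))
  claimed (just (true , i))  = cl (just (false , i))

punchInIx : Fin (suc l) → KEdgeIx l → KEdgeIx (suc l)
punchInIx i nothing        = nothing
punchInIx i (just (b , m)) = just (b , punchIn i m)

punchInIx-not-AtLeaf : ∀ (i : Fin (suc l)) j → ¬ AtLeaf i (punchInIx i j)
punchInIx-not-AtLeaf i (just (b , m)) (_ , eq) =
  punchInᵢ≢i i m (Maybe.just-injective (cong (Maybe.map proj₂) eq))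

KCopy-delete-leaf : ∀ i → KVerts (suc l) c x y u → (∀ j → Claimed S (kEdge c x y u (punchInIx i j))) →
                    KCopy l S c x y (u ∘ punchIn i)
KCopy-delete-leaf {c = c} {x = x} {y = y} {u = u} {S = S} i (c≢x , c≢y , x≢y , u-inj , u-new) cl =
  (c≢x , c≢y , x≢y , (λ {m} {m′} eq → punchIn-injective i m m′ (u-inj eq)) , u-new ∘ punchIn i) ,
  claimed
  where
  claimed : ∀ j → Claimed S (kEdge c x y (u ∘ punchIn i) j)
  claimed nothing            = cl nothing
  claimed (just (false , m)) = cl (just (false , m))
  claimed (just (true , m))  = cl (just (true , m))

NearCopy : List Edge → Vertex → Vertex → Vertex → (Fin l → Vertex) → KEdgeIx l → Set
NearCopy S c x y u j = ∀ j′ → j′ ≢ j → Claimed S (kEdge c x y u j′)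

NoK̂ : ℕ → List Edge → Vertex → Vertex → Set
NoK̂ l S c x = ¬ (∃[ y ] ∃[ u ] KCopy l S c x y u)

NoK̂-through-edge : NoK̂ l S c x → NoK̂ l S x c → KCopy l S c′ a y u →
                   SameEdge (c′ , a , w) (c , x , w) → w ≢ c′ → w ≢ a → ⊥
NoK̂-through-edge no-cx no-xc copy@(kv , _) c′aw~cxw w≢c′ w≢a
  with same-pair-through c′aw~cxw (KVertsProperties.c≢x kv) w≢c′ w≢a
... | inj₁ (refl , refl) = no-cx (_ , _ , copy)
... | inj₂ (refl , refl) = no-xc (_ , _ , copy)

-- Edges through a fresh vertex

claimed-through-fresh : Avoids S w → Claimed (f ∷ S) g → w ∈ᵉ g → SameEdge g f
claimed-through-fresh avoid (here g~f) _   = g~f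
claimed-through-fresh avoid (there cl) w∈g = ⊥-elim (avoid cl w∈g)

through-fresh-unique : Avoids S w → KVerts l c x y u → ∀ {j₁ j₂} →
                       Claimed (f ∷ S) (kEdge c x y u j₁) → Claimed (f ∷ S) (kEdge c x y u j₂) →
                       w ∈ᵉ kEdge c x y u j₁ → w ∈ᵉ kEdge c x y u j₂ → j₁ ≡ j₂
through-fresh-unique avoid kv {j₁} {j₂} cl₁ cl₂ w∈₁ w∈₂ =
  decidable-stable (j₁ ≟ᵢ j₂) λ j₁≢j₂ →
    kEdge-distinct kv j₁≢j₂ (SameEdge-trans (claimed-through-fresh avoid cl₁ w∈₁)
                                            (SameEdge-sym (claimed-through-fresh avoid cl₂ w∈₂)))

KCopy-avoids-fresh-edge : Avoids S w → w ∈ᵉ f → KCopy (suc l) (f ∷ S) c x y u → KCopy (suc l) S c x y u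
KCopy-avoids-fresh-edge {S = S} {c = c} {x = x} {y = y} {u = u} avoid w∈f (kv , cl) = kv , claimed
  where
  claimed : ∀ j → Claimed S (kEdge c x y u j)
  claimed j with cl j
  ... | there clS = clS
  ... | here Kj~f with ∈ᵉ-resp (SameEdge-sym Kj~f) w∈f
  ...   | w∈Kj with another-kEdge-through j w∈Kj
  ...     | j′ , j′≢j , w∈Kj′ = ⊥-elim (j′≢j (through-fresh-unique avoid kv (cl j′) (cl j) w∈Kj′ w∈Kj))

module BlockingEdge {l S f c x w} (avoid : Avoids S w) (f~cxw : SameEdge f (c , x , w))
  (no-cx : NoK̂ (suc l) S c x) (no-xc : NoK̂ (suc l) S x c)
  {c′ x′ y′ : Vertex} {u′ : Fin (suc (suc l)) → Vertex} {jm : KEdgeIx (suc (suc l))}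
  (kv : KVerts (suc (suc l)) c′ x′ y′ u′) (near : NearCopy (f ∷ S) c′ x′ y′ u′ jm) where

  open KVertsProperties kv using (uᵢ≢c; uᵢ≢x; uᵢ≢y)

  K : KEdgeIx (suc (suc l)) → Edge
  K = kEdge c′ x′ y′ u′

  w∈f : w ∈ᵉ f
  w∈f = ∈ᵉ-resp (SameEdge-sym f~cxw) ∈ᵉ₃

  through-w-unique : ∀ {j₁ j₂} → j₁ ≢ jm → j₂ ≢ jm → w ∈ᵉ K j₁ → w ∈ᵉ K j₂ → j₁ ≡ j₂
  through-w-unique j₁≢jm j₂≢jm = through-fresh-unique avoid kv (near _ j₁≢jm) (near _ j₂≢jm)

  through-w-blocking : ∀ {j} → j ≢ jm → w ∈ᵉ K j → SameEdge (K j) (c , x , w)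
  through-w-blocking j≢jm w∈Kj = SameEdge-trans (claimed-through-fresh avoid (near _ j≢jm) w∈Kj) f~cxw

  not-on-three-edges : ∀ {A B C} → A ≢ B → A ≢ C → B ≢ C → w ∈ᵉ K A → w ∈ᵉ K B → w ∈ᵉ K C → ⊥
  not-on-three-edges {A} {B} A≢B A≢C B≢C w∈A w∈B w∈C with A ≟ᵢ jm | B ≟ᵢ jm
  ... | yes A≡jm | _ = B≢C (through-w-unique (λ B≡jm → A≢B (trans A≡jm (sym B≡jm)))
                                              (λ C≡jm → A≢C (trans A≡jm (sym C≡jm))) w∈B w∈C)
  ... | no A≢jm | yes B≡jm = A≢C (through-w-unique A≢jm (λ C≡jm → B≢C (trans B≡jm (sym C≡jm))) w∈A w∈C)
  ... | no A≢jm | no B≢jm  = A≢B (through-w-unique A≢jm B≢jm w∈A w∈B)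

  not-hub : w ≡ c′ ⊎ w ≡ x′ ⊎ w ≡ y′ → ⊥
  not-hub (inj₁ w≡c′) =
    not-on-three-edges {nothing} {just (false , zero)} {just (false , suc zero)} (λ ()) (λ ()) (λ ())
      (inj₁ w≡c′) (inj₁ w≡c′) (inj₁ w≡c′)
  not-hub (inj₂ (inj₁ w≡x′)) =
    not-on-three-edges {nothing} {just (false , zero)} {just (false , suc zero)} (λ ()) (λ ()) (λ ())
      (inj₂ (inj₁ w≡x′)) (inj₂ (inj₁ w≡x′)) (inj₂ (inj₁ w≡x′))
  not-hub (inj₂ (inj₂ w≡y′)) =
    not-on-three-edges {nothing} {just (true , zero)} {just (true , suc zero)} (λ ()) (λ ()) (λ ())
      (inj₂ (inj₂ w≡y′)) (inj₂ (inj₁ w≡y′)) (inj₂ (inj₁ w≡y′))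

  leaf-deleted : ∀ i → w ≡ u′ i → AtLeaf i jm → KCopy (suc l) S c′ x′ y′ (u′ ∘ punchIn i)
  leaf-deleted i w≡uᵢ jm-at-i = KCopy-delete-leaf i kv claimed
    where
    claimed : ∀ j → Claimed S (K (punchInIx i j))
    claimed j with near (punchInIx i j)
                        (λ eq → punchInIx-not-AtLeaf i j (subst (AtLeaf i) (sym eq) jm-at-i))
    ... | there cl  = cl
    ... | here Kj~f =
      ⊥-elim (punchInIx-not-AtLeaf i j (kEdge-through-leaf kv (punchInIx i j)
        (subst (_∈ᵉ K (punchInIx i j)) w≡uᵢ (∈ᵉ-resp (SameEdge-sym Kj~f) w∈f))))

  not-leaf : ∀ i → w ≡ u′ i → ⊥
  not-leaf i w≡uᵢ with jm ≟ᵢ just (false , i) | jm ≟ᵢ just (true , i)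
  ... | no jm≢xᵢ | no jm≢yᵢ =
    leaf-sides-differ (through-w-unique (jm≢xᵢ ∘ sym) (jm≢yᵢ ∘ sym) (inj₂ (inj₂ w≡uᵢ)) (inj₂ (inj₂ w≡uᵢ)))
  ... | _ | yes jm≡yᵢ =
    NoK̂-through-edge no-cx no-xc (leaf-deleted i w≡uᵢ (true , jm≡yᵢ))
      (subst (λ v → SameEdge _ (c , x , v)) w≡uᵢ
        (through-w-blocking {just (false , i)} (λ eq → leaf-sides-differ (trans eq jm≡yᵢ))
                            (inj₂ (inj₂ w≡uᵢ))))
      (uᵢ≢c i) (uᵢ≢x i)
  ... | yes jm≡xᵢ | _ =
    NoK̂-through-edge no-cx no-xc (KCopy-swap (leaf-deleted i w≡uᵢ (false , jm≡xᵢ)))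
      (subst (λ v → SameEdge _ (c , x , v)) w≡uᵢ
        (through-w-blocking {just (true , i)} (λ eq → leaf-sides-differ (sym (trans eq jm≡xᵢ)))
                            (inj₂ (inj₂ w≡uᵢ))))
      (uᵢ≢c i) (uᵢ≢y i)

  near-copy-avoids : NearCopy S c′ x′ y′ u′ jm
  near-copy-avoids j j≢jm with near j j≢jm
  ... | there cl  = cl
  ... | here Kj~f with kEdge-vertex j (∈ᵉ-resp (SameEdge-sym Kj~f) w∈f)
  ...   | inj₁ hub        = ⊥-elim (not-hub hub)
  ...   | inj₂ (i , w≡uᵢ) = ⊥-elim (not-leaf i w≡uᵢ)

NearCopy-avoids-blocking-edge :
  Avoids S w → SameEdge f (c , x , w) → NoK̂ (suc l) S c x → NoK̂ (suc l) S x c → ∀ {jm} →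
  KVerts (suc (suc l)) c′ x′ y′ u → NearCopy (f ∷ S) c′ x′ y′ u jm → NearCopy S c′ x′ y′ u jm
NearCopy-avoids-blocking-edge avoid f~cxw no-cx no-xc kv near =
  BlockingEdge.near-copy-avoids avoid f~cxw no-cx no-xc kv near

-- The game

no-threat⇒no-immediate-win : ¬ Threat p → ¬ HasG (red p) → ¬ Claimed (blue p) e → ¬ HasG (e ∷ red p)
no-threat⇒no-immediate-win {p = p} ¬threat ¬G ¬blue (c , x , y , u , kv , cl)
  with ∃-KEdgeIx? (λ j → ¬? (Claimed? (red p) (kEdge c x y u j)))
... | no all-red =
  ¬G (c , x , y , u , kv , λ j → decidable-stable (Claimed? _ _) (λ ¬red → all-red (j , ¬red)))
... | yes (j , ¬red) with cl j
...   | there red = ¬red red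
...   | here Kj~e = ¬threat (c , x , y , u , j , kv , others , ¬red , ¬blue ∘ Claimed-resp Kj~e)
  where
  others : NearCopy (red p) c x y u j
  others j′ j′≢j with cl j′
  ... | there red′ = red′
  ... | here Kj′~e = ⊥-elim (kEdge-distinct kv j′≢j (SameEdge-trans Kj′~e (SameEdge-sym Kj~e)))

PlayPos⇒¬HasG-red : ∀ {t} → PlayPos p t → ¬ HasG (red p)
PlayPos⇒¬HasG-red start (_ , _ , _ , _ , _ , cl) = case cl nothing of λ ()
PlayPos⇒¬HasG-red (move1 _ _ ¬G)                 = ¬G
PlayPos⇒¬HasG-red (move2 play _ _)               = PlayPos⇒¬HasG-red play

module Blocking {c x y : Vertex} {u : Fin 3 → Vertex} (kv : KVerts 3 c x y u) where

  open KVertsProperties kv using (c≢x; c≢y)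

  lastVertex : List Edge → Vertex
  lastVertex []                = 0
  lastVertex ((_ , _ , w) ∷ _) = w

  -- w is the new vertex of P₂'s previous move c y w; if P₁ left c x w open, it completes P₂'s K̂_{2,4}.
  Ready : Pos → Set
  Ready p = let w = lastVertex (blue p) in
            Claimed (blue p) (c , y , w) × Free p (c , x , w) × NewVertex c x y u w

  Ready? : ∀ p → Dec (Ready p)
  Ready? p = Claimed? (blue p) _ ×-dec Free? p _ ×-dec NewVertex? c x y u _

  respond : (p : Pos) → Dec (Ready p) → Edge
  respond p (yes _) = c , x , lastVertex (blue p)
  respond p (no _)  = c , y , fresh p

  σ : Strategy
  σ p = respond p (Ready? p)

  BlueCopy : Pos → Set
  BlueCopy p = ∀ j → Claimed (blue p) (kEdge c x y u j)

  Safe : Pos → Set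
  Safe p = ¬ Threat p × NoK̂ 3 (red p) c x × NoK̂ 3 (red p) x c × ¬ HasG (red p)

  Invariant : Pos → Set
  Invariant p = BlueCopy p × (Ready p ⊎ Safe p)

  ready-wins : BlueCopy p → Ready p → HasG ((c , x , lastVertex (blue p)) ∷ blue p)
  ready-wins blue-K (cyw , _ , new) =
    c , x , y , _ , KCopy-extend (kv , there ∘ blue-K) (here SameEdge-refl) (there cyw) new

  fresh-edge-free : ∀ p → BlueCopy p → Free p (c , y , fresh p)
  fresh-edge-free p blue-K with avoids⇒NewVertex (fresh-avoids-blue p) blue-K
  ... | w≢c , _ , w≢y , _ =
    (c≢y , w≢c ∘ sym , w≢y ∘ sym) , (λ r → fresh-avoids-red p r ∈ᵉ₃) , (λ b → fresh-avoids-blue p b ∈ᵉ₃)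

  unanswered⇒ready : BlueCopy p → ¬ SameEdge e (c , x , fresh p) →
                     Ready (addRed e (addBlue (c , y , fresh p) p))
  unanswered⇒ready {p = p} {e = e} blue-K e≁cxw =
    here SameEdge-refl , ((c≢x , w≢c ∘ sym , w≢x ∘ sym) , ¬red , ¬blue) , new
    where
    new : NewVertex c x y u (fresh p)
    new = avoids⇒NewVertex (fresh-avoids-blue p) blue-K
    w≢c : fresh p ≢ c
    w≢c = proj₁ new
    w≢x : fresh p ≢ x
    w≢x = proj₁ (proj₂ new)
    ¬red : ¬ Claimed (e ∷ red p) (c , x , fresh p)
    ¬red (here cxw~e) = e≁cxw (SameEdge-sym cxw~e)
    ¬red (there r)    = fresh-avoids-red p r ∈ᵉ₃
    ¬blue : ¬ Claimed ((c , y , fresh p) ∷ blue p) (c , x , fresh p)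
    ¬blue (here cxw~cyw) =
      kEdge-distinct (KVerts-∷ kv new) {just (false , zero)} {just (true , zero)} (λ ()) cxw~cyw
    ¬blue (there b)      = fresh-avoids-blue p b ∈ᵉ₃

  blocked⇒safe : ∀ {b} → Safe p → SameEdge e (c , x , fresh p) → ¬ HasG (e ∷ red p) →
                 Safe (addRed e (addBlue b p))
  blocked⇒safe {p = p} {e = e} (¬threat , no-cx , no-xc , _) e~cxw ¬G =
    (λ (c′ , x′ , y′ , u′ , j , kv′ , near , ¬red , ¬blue) →
       ¬threat (c′ , x′ , y′ , u′ , j , kv′ ,
                NearCopy-avoids-blocking-edge (fresh-avoids-red p) e~cxw no-cx no-xc kv′ near ,
                ¬red ∘ there , ¬blue ∘ there)) ,
    (λ (y′ , u′ , copy) → no-cx (y′ , u′ , KCopy-avoids-fresh-edge (fresh-avoids-red p) w∈e copy)) ,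
    (λ (y′ , u′ , copy) → no-xc (y′ , u′ , KCopy-avoids-fresh-edge (fresh-avoids-red p) w∈e copy)) ,
    ¬G
    where
    w∈e : fresh p ∈ᵉ e
    w∈e = ∈ᵉ-resp (SameEdge-sym e~cxw) ∈ᵉ₃

  step-preserves : Invariant p → (r : Dec (Ready p)) → ¬ HasG (respond p r ∷ blue p) →
                   Free (addBlue (respond p r) p) e → ¬ HasG (e ∷ red p) →
                   Invariant (addRed e (addBlue (respond p r) p))
  step-preserves (blue-K , _) (yes ready) ¬win _ _ = ⊥-elim (¬win (ready-wins blue-K ready))
  step-preserves (blue-K , inj₁ ready) (no ¬ready) _ _ _ = ⊥-elim (¬ready ready)
  step-preserves {p = p} {e = e} (blue-K , inj₂ safe) (no _) _ _ ¬G with SameEdge? e (c , x , fresh p)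
  ... | yes e~cxw = there ∘ blue-K , inj₂ (blocked⇒safe safe e~cxw ¬G)
  ... | no  e≁cxw = there ∘ blue-K , inj₁ (unanswered⇒ready blue-K e≁cxw)

  invariant : ∀ {p₀} → Invariant p₀ → Consistent σ p₀ p → Invariant p
  invariant inv₀ here                      = inv₀
  invariant inv₀ (step reach ¬win free ¬G) = step-preserves (invariant inv₀ reach) (Ready? _) ¬win free ¬G

  σ-draws : Invariant p → (r : Dec (Ready p)) → Free p (respond p r) ×
            (¬ HasG (respond p r ∷ blue p) → ∀ e → Free (addBlue (respond p r) p) e → ¬ HasG (e ∷ red p))
  σ-draws (blue-K , _) (yes ready@(_ , free , _)) = free , λ ¬win → ⊥-elim (¬win (ready-wins blue-K ready))
  σ-draws (blue-K , inj₁ ready) (no ¬ready) = ⊥-elim (¬ready ready)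
  σ-draws (blue-K , inj₂ (¬threat , _ , _ , ¬G)) (no _) =
    fresh-edge-free _ blue-K ,
    λ _ e (_ , _ , ¬blue) → no-threat⇒no-immediate-win ¬threat ¬G (¬blue ∘ there)

lemma3p2 : (p : Pos) → PlayPos p P2turn →
    (c x y : ℕ) → (u : Fin 3 → ℕ) → KCopy 3 (blue p) c x y u →
    ¬ Threat p →
    ¬ (∃[ y' ] ∃[ u' ] KCopy 3 (red p) c x y' u') →
    ¬ (∃[ y' ] ∃[ u' ] KCopy 3 (red p) x c y' u') →
    Σ Strategy λ σ → DrawingStrategy σ p
lemma3p2 p play c x y u (kv , blue-K) ¬threat no-cx no-xc =
  σ , λ p′ reach → σ-draws (invariant initial reach) (Ready? p′)
  where
  open Blocking kv
  initial : Invariant p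
  initial = blue-K , inj₂ (¬threat , no-cx , no-xc , PlayPos⇒¬HasG-red play)
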